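{- Let $T$ be a tree and let $L$ be the set of pendant edges of $T$ (edges incident to a vertex of degree one). Then ${\rm gp_{e}}(T) = |L|$.
   Context: Graphs are finite and simple. A geodesic is a shortest path. A set $S$ of edges of a graph $G$ is an edge general position set if no geodesic of $G$ contains three edges of $S$; ${\rm gp_{e}}(G)$ is the maximum cardinality of an edge general position set of $G$. -}

module Defs where

open import Data.Nat using (ℕ; zero; suc; _≤_; _<_; _∸_; _≡ᵇ_; _<ᵇ_)
open import Data.Fin using (Fin; toℕ)
open import Data.Bool using (Bool; true; false; if_then_else_; _∧_; _∨_)
open import Data.List using (List; []; _∷_; length; head; last; allFin; filterᵇ; concatMap; map)
open import Data.Nat.ListAction using (sum)
open import Data.List.Relation.Unary.All using (All)
open import Data.List.Relation.Unary.Unique.Propositional using (Unique)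
open import Data.List.Membership.Propositional using (_∈_)
open import Data.Maybe using (just)
open import Data.Product using (_×_; _,_; ∃; Σ; proj₁; proj₂)
open import Data.Sum using (_⊎_)
open import Data.Empty using (⊥)
open import Data.Unit using (⊤)
open import Relation.Nullary using (¬_)
open import Relation.Binary.PropositionalEquality using (_≡_; _≢_)

record Graph (n : ℕ) : Set where
  field
    adj    : Fin n → Fin n → Bool
    sym    : ∀ i j → adj i j ≡ adj j i
    irrefl : ∀ i → adj i i ≡ false
open Graph public

module _ {n : ℕ} (G : Graph n) where

  -- An edge {i,j} is represented canonically as the pair (i , j) with i < j.
  IsEdge : Fin n × Fin n → Set
  IsEdge (i , j) = (toℕ i < toℕ j) × (adj G i j ≡ true)

  Consecutive : List (Fin n) → Set
  Consecutive []           = ⊤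
  Consecutive (x ∷ [])     = ⊤
  Consecutive (x ∷ y ∷ r)  = (adj G x y ≡ true) × Consecutive (y ∷ r)

  IsPath : Fin n → Fin n → List (Fin n) → Set
  IsPath u v p = (head p ≡ just u) × (last p ≡ just v) × Consecutive p × Unique p

  IsGeodesic : Fin n → Fin n → List (Fin n) → Set
  IsGeodesic u v p = IsPath u v p × (∀ q → IsPath u v q → length p ≤ length q)

  Connected : Set
  Connected = ∀ u v → ∃ λ p → IsPath u v p

  IsCycle : List (Fin n) → Set
  IsCycle c = (3 ≤ length c) × Consecutive c × Unique c ×
              ∃ λ u → ∃ λ v → (head c ≡ just u) × (last c ≡ just v) × (adj G v u ≡ true)

  Acyclic : Set
  Acyclic = ∀ c → ¬ IsCycle c

  IsTree : Set
  IsTree = Connected × Acyclic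

  EdgeOn : Fin n × Fin n → List (Fin n) → Set
  EdgeOn e []          = ⊥
  EdgeOn e (x ∷ [])    = ⊥
  EdgeOn e (x ∷ y ∷ r) = ((x , y) ≡ e ⊎ (y , x) ≡ e) ⊎ EdgeOn e (y ∷ r)

  IsEdgeSet : List (Fin n × Fin n) → Set
  IsEdgeSet S = All IsEdge S × Unique S

  IsEdgeGPSet : List (Fin n × Fin n) → Set
  IsEdgeGPSet S = IsEdgeSet S ×
    (∀ u v p → IsGeodesic u v p →
      ¬ (∃ λ e₁ → ∃ λ e₂ → ∃ λ e₃ →
           (e₁ ∈ S) × (e₂ ∈ S) × (e₃ ∈ S) ×
           (e₁ ≢ e₂) × (e₁ ≢ e₃) × (e₂ ≢ e₃) ×
           EdgeOn e₁ p × EdgeOn e₂ p × EdgeOn e₃ p))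

  GpeIs : ℕ → Set
  GpeIs k = (∃ λ S → IsEdgeGPSet S × length S ≡ k) ×
            (∀ S → IsEdgeGPSet S → length S ≤ k)

  degree : Fin n → ℕ
  degree i = sum (map (λ j → if adj G i j then 1 else 0) (allFin n))

  edges : List (Fin n × Fin n)
  edges = concatMap (λ i → map (λ j → (i , j))
            (filterᵇ (λ j → (toℕ i <ᵇ toℕ j) ∧ adj G i j) (allFin n))) (allFin n)

  pendantEdges : List (Fin n × Fin n)
  pendantEdges = filterᵇ (λ e → (degree (proj₁ e) ≡ᵇ 1) ∨ (degree (proj₂ e) ≡ᵇ 1)) edges

-- An end of a pendant edge has degree one, so it can only be an end of a path: a path carries at
-- most two pendant edges, its first and its last, and the pendant edges are in general position.
--
-- Conversely, let S be an edge general position set of an acyclic graph. Paths are then unique,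
-- hence geodesic. Call the side (a , b) of an edge ab ∈ S crowded if some path starting with a, b
-- carries another edge of S. The two sides cannot both be crowded: the witnessing paths join through ab
-- into one path carrying three edges of S. Walking from ab through an uncrowded side until no new
-- vertex is reachable ends at a leaf, which sends ab to a pendant edge. If distinct ab, cd ∈ S were
-- sent to the same pendant edge, their paths to the common leaf would produce a path leaving one of
-- them on its uncrowded side and carrying the other. So S injects into the pendant edges.

module Submission where

open import Defs renaming (sym to adj-sym; irrefl to adj-irrefl)

open import Data.Bool using (true; false; if_then_else_; _∧_)
import Data.Bool.Properties as Bool
open import Data.Bool.Properties using (T-∧; T-∨; T-≡)
open import Data.Empty using (⊥; ⊥-elim)
open import Data.Fin using (Fin; toℕ)
import Data.Fin.Properties as Fin
open import Data.List using (List; []; _∷_; _++_; _∷ʳ_; [_]; length; head; last; reverse; allFin; map; filterᵇ)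
open import Data.List.Properties using (reverse-++; unfold-reverse; reverse-involutive; length-tabulate; ++-assoc)
open import Data.List.Membership.Propositional using (_∈_; _∉_)
open import Data.List.Membership.Propositional.Properties
  using (∈-allFin; ∈-∃++; ∈-++⁺ˡ; ∈-++⁻; ∈-map⁺; ∈-map⁻; ∈-filter⁺; ∈-filter⁻; ∈-concatMap⁺; ∈-concatMap⁻)
open import Data.List.Relation.Binary.Disjoint.Propositional using (Disjoint)
open import Data.List.Relation.Unary.All using (All; []; _∷_; tabulate; lookup; sequenceM)
import Data.List.Relation.Unary.All.Properties as All
open import Data.List.Relation.Unary.AllPairs using ([]; _∷_)
import Data.List.Relation.Unary.AllPairs.Properties as AllPairs
open import Data.List.Relation.Unary.Any using (here; there)
import Data.List.Relation.Unary.Any as Any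
import Data.List.Relation.Unary.Any.Properties as Any
open import Data.List.Relation.Unary.Unique.Propositional using (Unique) renaming (tail to Unique-tail)
import Data.List.Relation.Unary.Unique.Propositional.Properties as Unique
open import Data.List.Relation.Unary.Unique.Propositional.Properties using (Unique[x∷xs]⇒x∉xs; allFin⁺)
open import Data.Maybe using (just)
open import Data.Maybe.Properties using (just-injective)
open import Data.Nat using (ℕ; zero; suc; _≤_; z≤n; s≤s; _+_; _<ᵇ_)
import Data.Nat.Properties as ℕ
open import Data.Nat.ListAction using (sum)
open import Data.Product using (Σ; ∃; ∃₂; _×_; _,_; proj₁; proj₂; uncurry)
open import Data.Product.Properties using (≡-dec)
open import Data.Sum using (_⊎_; inj₁; inj₂)
import Data.Sum as Sum
open import Data.Unit using (tt)
open import Function using (_∘_; id; Equivalence)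
open import Relation.Binary.Definitions using (tri<; tri≈; tri>)
open import Relation.Binary.PropositionalEquality using (_≡_; _≢_; refl; sym; trans; cong; subst)
open import Relation.Nullary using (¬_; ¬?; yes; no)
open import Relation.Nullary.Decidable using (_×-dec_; decidable-stable)
open import Relation.Nullary.Negation using (¬¬-map; ¬¬-Monad)

module _ {A : Set} where

  last-++-∷ : (xs : List A) {y : A} {ys : List A} → last (xs ++ y ∷ ys) ≡ last (y ∷ ys)
  last-++-∷ []           = refl
  last-++-∷ (_ ∷ [])     = refl
  last-++-∷ (_ ∷ x ∷ xs) = last-++-∷ (x ∷ xs)

  head-++ : {xs : List A} (ys : List A) {x : A} → head xs ≡ just x → head (xs ++ ys) ≡ just x
  head-++ {_ ∷ _} ys eq = eq

  last-reverse : (xs : List A) → last (reverse xs) ≡ head xs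
  last-reverse []       = refl
  last-reverse (x ∷ xs) = trans (cong last (unfold-reverse x xs)) (last-++-∷ (reverse xs))

  head-reverse : (xs : List A) → head (reverse xs) ≡ last xs
  head-reverse xs = trans (sym (last-reverse (reverse xs))) (cong last (reverse-involutive xs))

  head⇒∈ : ∀ {x} (xs : List A) → head xs ≡ just x → x ∈ xs
  head⇒∈ (_ ∷ _) refl = here refl

  last⇒∈ : ∀ {x} (xs : List A) → last xs ≡ just x → x ∈ xs
  last⇒∈ []           ()
  last⇒∈ (_ ∷ [])     refl = here refl
  last⇒∈ (_ ∷ y ∷ ys) eq   = there (last⇒∈ (y ∷ ys) eq)

  Unique-reverse : {xs : List A} → Unique xs → Unique (reverse xs)
  Unique-reverse {[]}     []         = []
  Unique-reverse {x ∷ xs} (x∉ ∷ xs!) rewrite unfold-reverse x xs =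
    Unique.++⁺ (Unique-reverse xs!) ([] ∷ [])
      λ { (x∈ , here refl) → Unique[x∷xs]⇒x∉xs (x∉ ∷ xs!) (Any.reverse⁻ x∈) }

  Unique-++⁻ˡ : (xs : List A) {ys : List A} → Unique (xs ++ ys) → Unique xs
  Unique-++⁻ˡ []       _          = []
  Unique-++⁻ˡ (_ ∷ xs) (x∉ ∷ xs!) = All.++⁻ˡ xs x∉ ∷ Unique-++⁻ˡ xs xs!

  Unique-++⁻ʳ : (xs : List A) {ys : List A} → Unique (xs ++ ys) → Unique ys
  Unique-++⁻ʳ []       xs!       = xs!
  Unique-++⁻ʳ (_ ∷ xs) (_ ∷ xs!) = Unique-++⁻ʳ xs xs!

  ≤-sum-map : (f : A → ℕ) {x : A} {xs : List A} → x ∈ xs → f x ≤ sum (map f xs)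
  ≤-sum-map f {xs = y ∷ _} (here refl) = ℕ.m≤m+n (f y) _
  ≤-sum-map f {xs = y ∷ _} (there x∈)  = ℕ.≤-trans (≤-sum-map f x∈) (ℕ.m≤n+m _ (f y))

  2≤-sum-map : (f : A → ℕ) {x y : A} {xs : List A} → x ∈ xs → y ∈ xs → x ≢ y →
               1 ≤ f x → 1 ≤ f y → 2 ≤ sum (map f xs)
  2≤-sum-map f (here refl) (here refl) x≢y _ _ = ⊥-elim (x≢y refl)
  2≤-sum-map f (here refl) (there y∈)  _ 1≤fx 1≤fy = ℕ.+-mono-≤ 1≤fx (ℕ.≤-trans 1≤fy (≤-sum-map f y∈))
  2≤-sum-map f (there x∈)  (here refl) _ 1≤fx 1≤fy = ℕ.+-mono-≤ 1≤fy (ℕ.≤-trans 1≤fx (≤-sum-map f x∈))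
  2≤-sum-map f {xs = z ∷ _} (there x∈) (there y∈) x≢y 1≤fx 1≤fy =
    ℕ.≤-trans (2≤-sum-map f x∈ y∈ x≢y 1≤fx 1≤fy) (ℕ.m≤n+m _ (f z))

  sum-map≡0 : (f : A → ℕ) {xs : List A} → (∀ {y} → y ∈ xs → f y ≡ 0) → sum (map f xs) ≡ 0
  sum-map≡0 f {[]}     _     = refl
  sum-map≡0 f {y ∷ xs} fxs≡0 rewrite fxs≡0 (here refl) = sum-map≡0 f (fxs≡0 ∘ there)

  sum-map≡1 : (f : A → ℕ) {x : A} {xs : List A} → Unique xs → x ∈ xs → f x ≡ 1 →
              (∀ y → y ≢ x → f y ≡ 0) → sum (map f xs) ≡ 1
  sum-map≡1 f xs! (here refl) fx≡1 others rewrite fx≡1 =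
    cong suc (sum-map≡0 f λ y∈ → others _ λ { refl → Unique[x∷xs]⇒x∉xs xs! y∈ })
  sum-map≡1 f {xs = y ∷ _} xs! (there x∈) fx≡1 others
    rewrite others y (λ { refl → Unique[x∷xs]⇒x∉xs xs! x∈ }) = sum-map≡1 f (Unique-tail xs!) x∈ fx≡1 others

¬¬-¬⊎¬ : {A B : Set} → (A → B → ⊥) → ¬ ¬ (¬ A ⊎ ¬ B)
¬¬-¬⊎¬ not-both k = k (inj₁ λ a → k (inj₂ (not-both a)))

module _ {A B : Set} where

  private
    remove : ∀ {y} (ys : List B) → y ∈ ys →
             Σ (List B) λ ys′ → length ys ≡ suc (length ys′) × (∀ {z} → z ∈ ys → z ≢ y → z ∈ ys′)
    remove (_ ∷ ys) (here refl) = ys , refl , λ { (here refl) z≢y → ⊥-elim (z≢y refl) ; (there z∈) _ → z∈ }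
    remove (y ∷ ys) (there x∈) with ys′ , eq , keep ← remove ys x∈ =
      y ∷ ys′ , cong suc eq , λ { (here refl) _ → here refl ; (there z∈) z≢x → there (keep z∈ z≢x) }

  length-≤-by-injection : (R : A → B → Set) {xs : List A} {ys : List B} → Unique xs →
    (∀ {x} → x ∈ xs → ∃ λ y → y ∈ ys × R x y) →
    (∀ {x x′ y} → x ∈ xs → x′ ∈ xs → R x y → R x′ y → x ≡ x′) →
    length xs ≤ length ys
  length-≤-by-injection R {[]}     _          _     _   = z≤n
  length-≤-by-injection R {x ∷ xs} {ys} (x∉ ∷ xs!) image inj
    with y , y∈ys , Rxy ← image (here refl)
    with ys′ , |ys|≡ , keep ← remove ys y∈ys =
    subst (suc (length xs) ≤_) (sym |ys|≡)
      (s≤s (length-≤-by-injection R xs! image′ (λ x∈ x′∈ → inj (there x∈) (there x′∈))))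
    where
    image′ : ∀ {x′} → x′ ∈ xs → ∃ λ y′ → y′ ∈ ys′ × R x′ y′
    image′ {x′} x′∈xs with y′ , y′∈ys , Rx′y′ ← image (there x′∈xs) =
      y′ , keep y′∈ys y′≢y , Rx′y′
      where
      y′≢y : y′ ≢ y
      y′≢y refl = Unique[x∷xs]⇒x∉xs (x∉ ∷ xs!)
        (subst (_∈ xs) (inj (there x′∈xs) (here refl) Rx′y′ Rxy) x′∈xs)

Unique⇒length≤ : ∀ {n} {xs : List (Fin n)} → Unique xs → length xs ≤ n
Unique⇒length≤ {n} {xs} xs! = subst (length xs ≤_) (length-tabulate (λ i → i))
  (length-≤-by-injection _≡_ {ys = allFin n} xs! (λ {x} _ → x , ∈-allFin x , refl) (λ _ _ p q → trans p (sym q)))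

module _ {n : ℕ} (G : Graph n) where

  open import Data.List.Membership.DecPropositional (Fin._≟_ {n}) using (_∈?_)

  private
    V : Set
    V = Fin n

  Adjacent : V → V → Set
  Adjacent x y = adj G x y ≡ true

  Adjacent-sym : ∀ {x y} → Adjacent x y → Adjacent y x
  Adjacent-sym {x} {y} = trans (adj-sym G y x)

  Adjacent-irrefl : ∀ {x} → ¬ Adjacent x x
  Adjacent-irrefl {x} xx with () ← trans (sym (adj-irrefl G x)) xx

  Adjacent⇒≢ : ∀ {x y} → Adjacent x y → x ≢ y
  Adjacent⇒≢ xy refl = Adjacent-irrefl xy

  SimpleWalk : List V → Set
  SimpleWalk p = Consecutive G p × Unique p

  -- EdgeOn G g (a ∷ b ∷ r) unfolds to HasEnds g a b ⊎ EdgeOn G g (b ∷ r).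
  HasEnds : V × V → V → V → Set
  HasEnds g a b = (a , b) ≡ g ⊎ (b , a) ≡ g

  HasEnds-swap : ∀ {g a b} → HasEnds g a b → HasEnds g b a
  HasEnds-swap = Sum.swap

  HasEnds-cases : ∀ {g a b c d} → HasEnds g a b → HasEnds g c d → (a ≡ c × b ≡ d) ⊎ (a ≡ d × b ≡ c)
  HasEnds-cases (inj₁ refl) (inj₁ refl) = inj₁ (refl , refl)
  HasEnds-cases (inj₁ refl) (inj₂ refl) = inj₂ (refl , refl)
  HasEnds-cases (inj₂ refl) (inj₁ refl) = inj₂ (refl , refl)
  HasEnds-cases (inj₂ refl) (inj₂ refl) = inj₁ (refl , refl)

  IsEdge-unique : ∀ {g g′ a b} → IsEdge G g → IsEdge G g′ → HasEnds g a b → HasEnds g′ a b → g ≡ g′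
  IsEdge-unique _        _         (inj₁ refl) (inj₁ refl) = refl
  IsEdge-unique (a<b , _) (b<a , _) (inj₁ refl) (inj₂ refl) = ⊥-elim (ℕ.<-asym a<b b<a)
  IsEdge-unique (b<a , _) (a<b , _) (inj₂ refl) (inj₁ refl) = ⊥-elim (ℕ.<-asym b<a a<b)
  IsEdge-unique _        _         (inj₂ refl) (inj₂ refl) = refl

  Consecutive-tail : ∀ {x xs} → Consecutive G (x ∷ xs) → Consecutive G xs
  Consecutive-tail {xs = []}    _        = tt
  Consecutive-tail {xs = _ ∷ _} (_ , xs~) = xs~

  SimpleWalk-tail : ∀ {x xs} → SimpleWalk (x ∷ xs) → SimpleWalk xs
  SimpleWalk-tail (xs~ , xs!) = Consecutive-tail xs~ , Unique-tail xs!

  SimpleWalk-∷ : ∀ {z x xs} → Adjacent z x → z ∉ x ∷ xs → SimpleWalk (x ∷ xs) → SimpleWalk (z ∷ x ∷ xs)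
  SimpleWalk-∷ zx z∉ (xs~ , xs!) = (zx , xs~) , All.¬Any⇒All¬ _ z∉ ∷ xs!

  Consecutive-++⁻ˡ : (xs : List V) {ys : List V} → Consecutive G (xs ++ ys) → Consecutive G xs
  Consecutive-++⁻ˡ []           _           = tt
  Consecutive-++⁻ˡ (_ ∷ [])     _           = tt
  Consecutive-++⁻ˡ (_ ∷ y ∷ xs) (xy , ys~)  = xy , Consecutive-++⁻ˡ (y ∷ xs) ys~

  Consecutive-++⁻ʳ : (xs : List V) {ys : List V} → Consecutive G (xs ++ ys) → Consecutive G ys
  Consecutive-++⁻ʳ []       ys~ = ys~
  Consecutive-++⁻ʳ (_ ∷ xs) ys~ = Consecutive-++⁻ʳ xs (Consecutive-tail ys~)

  Consecutive-++⁺ : (xs : List V) {x y : V} {ys : List V} → Consecutive G xs → last xs ≡ just x →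
                    Adjacent x y → Consecutive G (y ∷ ys) → Consecutive G (xs ++ y ∷ ys)
  Consecutive-++⁺ (_ ∷ [])     _          refl xy ys~ = xy , ys~
  Consecutive-++⁺ (_ ∷ z ∷ xs) (xz , xs~) eq   xy ys~ = xz , Consecutive-++⁺ (z ∷ xs) xs~ eq xy ys~

  Consecutive-reverse : (xs : List V) → Consecutive G xs → Consecutive G (reverse xs)
  Consecutive-reverse []           _          = tt
  Consecutive-reverse (x ∷ [])     _          = tt
  Consecutive-reverse (x ∷ y ∷ xs) (xy , xs~) = subst (Consecutive G) (sym (unfold-reverse x (y ∷ xs)))
    (Consecutive-++⁺ (reverse (y ∷ xs)) (Consecutive-reverse (y ∷ xs) xs~) (last-reverse (y ∷ xs))
      (Adjacent-sym xy) tt)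

  IsPath-reverse : ∀ {u v p} → IsPath G u v p → IsPath G v u (reverse p)
  IsPath-reverse {p = p} (hd , lst , p~ , p!) =
    trans (head-reverse p) lst , trans (last-reverse p) hd , Consecutive-reverse p p~ , Unique-reverse p!

  IsPath-++ : ∀ {u x y v p q} → IsPath G u x p → IsPath G y v q → Adjacent x y → Disjoint p q →
              IsPath G u v (p ++ q)
  IsPath-++ {p = p} {q = y ∷ q} (hd , lst , p~ , p!) (refl , lst′ , q~ , q!) xy p#q =
    head-++ (y ∷ q) hd , trans (last-++-∷ p) lst′ , Consecutive-++⁺ p p~ lst xy q~ , Unique.++⁺ p! q! p#q

  IsPath-prefix : ∀ {u v} (xs : List V) {ys : List V} → head (xs ++ v ∷ ys) ≡ just u →
                  SimpleWalk (xs ++ v ∷ ys) → IsPath G u v (xs ∷ʳ v)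
  IsPath-prefix {v = v} xs {ys} hd (p~ , p!) =
    trans (head-prefix xs) hd , last-++-∷ xs ,
    Consecutive-++⁻ˡ (xs ∷ʳ v) (subst (Consecutive G) (sym (++-assoc xs [ v ] ys)) p~) ,
    Unique-++⁻ˡ (xs ∷ʳ v) (subst Unique (sym (++-assoc xs [ v ] ys)) p!)
    where
    head-prefix : (xs : List V) → head (xs ∷ʳ v) ≡ head (xs ++ v ∷ ys)
    head-prefix []      = refl
    head-prefix (_ ∷ _) = refl

  IsPath-suffix : ∀ {v w} (xs : List V) {ys : List V} → last (xs ++ v ∷ ys) ≡ just w →
                  SimpleWalk (xs ++ v ∷ ys) → IsPath G v w (v ∷ ys)
  IsPath-suffix xs lst (p~ , p!) =
    refl , trans (sym (last-++-∷ xs)) lst , Consecutive-++⁻ʳ xs p~ , Unique-++⁻ʳ xs p!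

  IsPath-[_] : ∀ x → IsPath G x x [ x ]
  IsPath-[ x ] = refl , refl , tt , [] ∷ []

  IsPath-tail : ∀ {u v y p} → IsPath G u v (u ∷ y ∷ p) → IsPath G y v (y ∷ p)
  IsPath-tail (_ , lst , walk) = refl , lst , SimpleWalk-tail walk

  EdgeOn-∷ : ∀ {g x xs} → EdgeOn G g xs → EdgeOn G g (x ∷ xs)
  EdgeOn-∷ {xs = _ ∷ _} on = inj₂ on

  EdgeOn-++⁺ˡ : ∀ {g} (xs : List V) {ys : List V} → EdgeOn G g xs → EdgeOn G g (xs ++ ys)
  EdgeOn-++⁺ˡ (_ ∷ _ ∷ _)  (inj₁ ends) = inj₁ ends
  EdgeOn-++⁺ˡ (_ ∷ y ∷ xs) (inj₂ on)   = inj₂ (EdgeOn-++⁺ˡ (y ∷ xs) on)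

  EdgeOn-++⁺ʳ : ∀ {g} (xs : List V) {ys : List V} → EdgeOn G g ys → EdgeOn G g (xs ++ ys)
  EdgeOn-++⁺ʳ []       on = on
  EdgeOn-++⁺ʳ (_ ∷ xs) on = EdgeOn-∷ (EdgeOn-++⁺ʳ xs on)

  EdgeOn-junction : ∀ {g a b} (xs : List V) {ys : List V} → last xs ≡ just a → HasEnds g a b →
                    EdgeOn G g (xs ++ b ∷ ys)
  EdgeOn-junction (_ ∷ [])     refl ends = inj₁ ends
  EdgeOn-junction (_ ∷ y ∷ xs) lst  ends = inj₂ (EdgeOn-junction (y ∷ xs) lst ends)

  EdgeOn-reverse : ∀ {g} (xs : List V) → EdgeOn G g xs → EdgeOn G g (reverse xs)
  EdgeOn-reverse (x ∷ y ∷ xs) (inj₁ ends) = subst (EdgeOn G _) (sym (unfold-reverse x (y ∷ xs)))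
    (EdgeOn-junction (reverse (y ∷ xs)) (last-reverse (y ∷ xs)) (HasEnds-swap ends))
  EdgeOn-reverse (x ∷ y ∷ xs) (inj₂ on)   = subst (EdgeOn G _) (sym (unfold-reverse x (y ∷ xs)))
    (EdgeOn-++⁺ˡ (reverse (y ∷ xs)) (EdgeOn-reverse (y ∷ xs) on))

  EdgeOn⇒∈ : ∀ {g} (xs : List V) → EdgeOn G g xs → proj₁ g ∈ xs
  EdgeOn⇒∈ (_ ∷ _ ∷ _)  (inj₁ (inj₁ refl)) = here refl
  EdgeOn⇒∈ (_ ∷ _ ∷ _)  (inj₁ (inj₂ refl)) = there (here refl)
  EdgeOn⇒∈ (_ ∷ y ∷ xs) (inj₂ on)          = there (EdgeOn⇒∈ (y ∷ xs) on)

  private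
    Adjacent⇒indicator≡1 : ∀ {x y} → Adjacent x y → (if adj G x y then 1 else 0) ≡ 1
    Adjacent⇒indicator≡1 xy rewrite xy = refl

  degree≥2 : ∀ {x y z} → Adjacent x y → Adjacent x z → y ≢ z → 2 ≤ degree G x
  degree≥2 {x} {y} {z} xy xz y≢z = 2≤-sum-map _ (∈-allFin y) (∈-allFin z) y≢z
    (ℕ.≤-reflexive (sym (Adjacent⇒indicator≡1 xy))) (ℕ.≤-reflexive (sym (Adjacent⇒indicator≡1 xz)))

  degree≡1 : ∀ {x y} → Adjacent x y → (∀ z → Adjacent x z → z ≡ y) → degree G x ≡ 1
  degree≡1 {x} {y} xy only = sum-map≡1 _ (allFin⁺ n) (∈-allFin y) (Adjacent⇒indicator≡1 xy) others
    where
    others : ∀ z → z ≢ y → (if adj G x z then 1 else 0) ≡ 0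
    others z z≢y with adj G x z in xz
    ... | true  = ⊥-elim (z≢y (only z xz))
    ... | false = refl

  degree≥2⇒≢1 : ∀ {x} → 2 ≤ degree G x → degree G x ≢ 1
  degree≥2⇒≢1 2≤ eq = ℕ.<-irrefl refl (subst (2 ≤_) eq 2≤)

  private
    row : V → List (V × V)
    row i = map (i ,_) (filterᵇ (λ j → (toℕ i <ᵇ toℕ j) ∧ adj G i j) (allFin n))

  ∈-edges⁺ : ∀ {i j} → IsEdge G (i , j) → (i , j) ∈ edges G
  ∈-edges⁺ {i} {j} (i<j , ij) = ∈-concatMap⁺ row (Any.map (λ { refl → j∈row }) (∈-allFin i))
    where
    j∈row : (i , j) ∈ row i
    j∈row = ∈-map⁺ (i ,_)
      (∈-filter⁺ _ (∈-allFin j) (Equivalence.from T-∧ (ℕ.<⇒<ᵇ i<j , Equivalence.from T-≡ ij)))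

  ∈-edges⁻ : ∀ {g} → g ∈ edges G → IsEdge G g
  ∈-edges⁻ g∈ with i , g∈row ← Any.satisfied (∈-concatMap⁻ row {xs = allFin n} g∈)
                  with j , j∈ , refl ← ∈-map⁻ (i ,_) g∈row
                  with i<j , ij ← Equivalence.to T-∧ (proj₂ (∈-filter⁻ _ {xs = allFin n} j∈)) =
    ℕ.<ᵇ⇒< (toℕ i) (toℕ j) i<j , Equivalence.to T-≡ ij

  edges-unique : Unique (edges G)
  edges-unique = Unique.concat⁺ (All.map⁺ (All.tabulate⁺ row-unique))
                                (AllPairs.map⁺ (AllPairs.tabulate⁺-< (rows-disjoint ∘ Fin.<⇒≢)))
    where
    row-unique : ∀ i → Unique (row i)
    row-unique i = Unique.map⁺ (λ { refl → refl }) (Unique.filter⁺ _ (allFin⁺ n))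
    rows-disjoint : ∀ {i i′} → i ≢ i′ → Disjoint (row i) (row i′)
    rows-disjoint i≢i′ (g∈ , g∈′) with _ , _ , refl ← ∈-map⁻ _ g∈
                                    with _ , _ , eq ← ∈-map⁻ _ g∈′ = i≢i′ (cong proj₁ eq)

  Pendant : V × V → Set
  Pendant (a , b) = degree G a ≡ 1 ⊎ degree G b ≡ 1

  Pendant-ends : ∀ {g a b} → HasEnds g a b → Pendant g → degree G a ≡ 1 ⊎ degree G b ≡ 1
  Pendant-ends (inj₁ refl) = id
  Pendant-ends (inj₂ refl) = Sum.swap

  canonical-edge : ∀ {a b} → Adjacent a b → ∃ λ g → IsEdge G g × HasEnds g a b
  canonical-edge {a} {b} ab with ℕ.<-cmp (toℕ a) (toℕ b)
  ... | tri< a<b _ _ = (a , b) , (a<b , ab) , inj₁ refl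
  ... | tri> _ _ b<a = (b , a) , (b<a , Adjacent-sym ab) , inj₂ refl
  ... | tri≈ _ a≡b _ with refl ← Fin.toℕ-injective a≡b = ⊥-elim (Adjacent-irrefl ab)

  Pendant-intro : ∀ {g a b} → HasEnds g a b → degree G b ≡ 1 → Pendant g
  Pendant-intro (inj₁ refl) = inj₂
  Pendant-intro (inj₂ refl) = inj₁

  ∈-pendantEdges⁺ : ∀ {g} → IsEdge G g → Pendant g → g ∈ pendantEdges G
  ∈-pendantEdges⁺ {_ , _} edge pendant =
    ∈-filter⁺ _ (∈-edges⁺ edge) (Equivalence.from T-∨ (Sum.map (ℕ.≡⇒≡ᵇ _ 1) (ℕ.≡⇒≡ᵇ _ 1) pendant))

  ∈-pendantEdges⁻ : ∀ {g} → g ∈ pendantEdges G → IsEdge G g × Pendant g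
  ∈-pendantEdges⁻ g∈ with g∈edges , pendant ← ∈-filter⁻ _ {xs = edges G} g∈ =
    ∈-edges⁻ g∈edges , Sum.map (ℕ.≡ᵇ⇒≡ _ 1) (ℕ.≡ᵇ⇒≡ _ 1) (Equivalence.to T-∨ pendant)

  pendantEdges-unique : Unique (pendantEdges G)
  pendantEdges-unique = Unique.filter⁺ _ edges-unique

  interior-degree≥2 : ∀ {x y z r} → SimpleWalk (x ∷ y ∷ z ∷ r) → 2 ≤ degree G y
  interior-degree≥2 ((xy , yz , _) , ((_ ∷ x≢z ∷ _) ∷ _)) = degree≥2 (Adjacent-sym xy) yz x≢z

  lastEdge : V → V → List V → V × V
  lastEdge x y []      = x , y
  lastEdge _ y (z ∷ r) = lastEdge y z r

  pendant-first-or-last : ∀ {g} x y (r : List V) → SimpleWalk (x ∷ y ∷ r) → EdgeOn G g (x ∷ y ∷ r) →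
                          Pendant g → HasEnds g x y ⊎ uncurry (HasEnds g) (lastEdge x y r)
  pendant-first-or-last x y r       _    (inj₁ ends) _ = inj₁ ends
  pendant-first-or-last x y (z ∷ r) walk (inj₂ on) pendant
    with pendant-first-or-last y z r (SimpleWalk-tail walk) on pendant
  ... | inj₂ ends = inj₂ ends
  ... | inj₁ ends with r
  ...   | []    = inj₂ ends
  ...   | _ ∷ _ = ⊥-elim (Sum.[ degree≥2⇒≢1 (interior-degree≥2 walk)
                               , degree≥2⇒≢1 (interior-degree≥2 (SimpleWalk-tail walk)) ] (Pendant-ends ends pendant))

  private
    edge : ∀ {e} → e ∈ pendantEdges G → IsEdge G e
    edge = proj₁ ∘ ∈-pendantEdges⁻

  at-most-two-pendant : ∀ {e₁ e₂ e₃} (p : List V) → SimpleWalk p →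
                        e₁ ∈ pendantEdges G → e₂ ∈ pendantEdges G → e₃ ∈ pendantEdges G →
                        EdgeOn G e₁ p → EdgeOn G e₂ p → EdgeOn G e₃ p → e₁ ≡ e₂ ⊎ e₁ ≡ e₃ ⊎ e₂ ≡ e₃
  at-most-two-pendant (x ∷ y ∷ r) walk e₁∈ e₂∈ e₃∈ on₁ on₂ on₃
    with pendant-first-or-last x y r walk on₁ (proj₂ (∈-pendantEdges⁻ e₁∈))
       | pendant-first-or-last x y r walk on₂ (proj₂ (∈-pendantEdges⁻ e₂∈))
       | pendant-first-or-last x y r walk on₃ (proj₂ (∈-pendantEdges⁻ e₃∈))
  ... | inj₁ s₁ | inj₁ s₂ | _       = inj₁ (IsEdge-unique (edge e₁∈) (edge e₂∈) s₁ s₂)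
  ... | inj₂ s₁ | inj₂ s₂ | _       = inj₁ (IsEdge-unique (edge e₁∈) (edge e₂∈) s₁ s₂)
  ... | inj₁ s₁ | inj₂ _  | inj₁ s₃ = inj₂ (inj₁ (IsEdge-unique (edge e₁∈) (edge e₃∈) s₁ s₃))
  ... | inj₂ s₁ | inj₁ _  | inj₂ s₃ = inj₂ (inj₁ (IsEdge-unique (edge e₁∈) (edge e₃∈) s₁ s₃))
  ... | inj₁ _  | inj₂ s₂ | inj₂ s₃ = inj₂ (inj₂ (IsEdge-unique (edge e₂∈) (edge e₃∈) s₂ s₃))
  ... | inj₂ _  | inj₁ s₂ | inj₁ s₃ = inj₂ (inj₂ (IsEdge-unique (edge e₂∈) (edge e₃∈) s₂ s₃))

  pendantEdges-isEdgeGPSet : IsEdgeGPSet G (pendantEdges G)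
  pendantEdges-isEdgeGPSet =
    (tabulate edge , pendantEdges-unique) ,
    λ { _ _ p ((_ , _ , walk) , _)
          (_ , _ , _ , e₁∈ , e₂∈ , e₃∈ , e₁≢e₂ , e₁≢e₃ , e₂≢e₃ , on₁ , on₂ , on₃) →
        Sum.[ e₁≢e₂ , Sum.[ e₁≢e₃ , e₂≢e₃ ] ] (at-most-two-pendant p walk e₁∈ e₂∈ e₃∈ on₁ on₂ on₃) }

  connecting-path : ∀ {x y v} (p q : List V) → SimpleWalk (x ∷ p) → SimpleWalk (y ∷ q) →
                    v ∈ x ∷ p → v ∈ y ∷ q →
                    ∃ λ W → IsPath G x y W × (∀ {w} → w ∈ W → w ∈ x ∷ p ⊎ w ∈ y ∷ q)
  connecting-path {x} {y} p q walk walk′ v∈ v∈′ with x ∈? y ∷ q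
  ... | yes x∈ with q₁ , q₂ , eq ← ∈-∃++ x∈ =
    reverse (q₁ ∷ʳ x) ,
    IsPath-reverse (IsPath-prefix q₁ (cong head (sym eq)) (subst SimpleWalk eq walk′)) ,
    λ w∈ → inj₂ (subst (_ ∈_) (trans (++-assoc q₁ [ x ] q₂) (sym eq))
                  (∈-++⁺ˡ (Any.reverse⁻ {xs = q₁ ∷ʳ x} w∈)))
  connecting-path {x} {y} p q walk walk′ (here refl) v∈′ | no x∉ = ⊥-elim (x∉ v∈′)
  connecting-path {x} {y} (z ∷ p) q walk@((xz , _) , xp!) walk′ (there v∈) v∈′ | no x∉
    with W , path , W⊆ ← connecting-path p q (SimpleWalk-tail walk) walk′ v∈ v∈′ =
    x ∷ W ,
    IsPath-++ IsPath-[ x ] path xz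
      (λ { (here refl , x∈W) → Sum.[ Unique[x∷xs]⇒x∉xs xp! , x∉ ] (W⊆ x∈W) }) ,
    λ { (here refl) → inj₁ (here refl) ; (there w∈) → Sum.map₁ there (W⊆ w∈) }

  cycle-through : ∀ {u y y′ W} → IsPath G y y′ W → y ≢ y′ → Adjacent u y → Adjacent y′ u → u ∉ W →
                  IsCycle G (u ∷ W)
  cycle-through {W = _ ∷ []}    (refl , refl , _) y≢y′ = ⊥-elim (y≢y′ refl)
  cycle-through {W = _ ∷ _ ∷ _} (refl , lst , W~ , W!) _ uy y′u u∉W =
    s≤s (s≤s (s≤s z≤n)) , (uy , W~) , All.¬Any⇒All¬ _ u∉W ∷ W! , _ , _ , refl , lst , y′u

  MaximalExtension : List V → Set
  MaximalExtension w = ∃ λ pre → ∃₂ λ x y → ∃ λ t → x ∷ y ∷ t ≡ pre ++ w ×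
    SimpleWalk (x ∷ y ∷ t) × (∀ z → Adjacent x z → z ∈ x ∷ y ∷ t)

  extend-to-maximal : ∀ {x y t} → SimpleWalk (x ∷ y ∷ t) → MaximalExtension (x ∷ y ∷ t)
  extend-to-maximal {x} {y} {t} walk = extend n (ℕ.m≤n+m n (length (x ∷ y ∷ t))) walk
    where
    -- A simple walk has at most n vertices, so the fuel n is never exhausted.
    extend : ∀ {x y t} (fuel : ℕ) → n ≤ length (x ∷ y ∷ t) + fuel → SimpleWalk (x ∷ y ∷ t) →
             MaximalExtension (x ∷ y ∷ t)
    extend {x} {y} {t} fuel bound walk
      with Fin.any? (λ z → (adj G x z Bool.≟ true) ×-dec ¬? (z ∈? x ∷ y ∷ t))
    ... | no stuck = [] , x , y , t , refl , walk ,
          λ z xz → decidable-stable (z ∈? x ∷ y ∷ t) (λ z∉ → stuck (z , xz , z∉))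
    ... | yes (z , xz , z∉) with fuel
    ...   | zero =
      ⊥-elim (ℕ.<⇒≱ (Unique⇒length≤ (proj₂ (SimpleWalk-∷ (Adjacent-sym xz) z∉ walk)))
                    (subst (n ≤_) (ℕ.+-identityʳ _) bound))
    ...   | suc fuel′
      with pre , x′ , y′ , t′ , eq , walk′ , maximal ←
             extend fuel′ (subst (n ≤_) (ℕ.+-suc _ fuel′) bound) (SimpleWalk-∷ (Adjacent-sym xz) z∉ walk) =
      pre ∷ʳ z , x′ , y′ , t′ , trans eq (sym (++-assoc pre [ z ] (x ∷ y ∷ t))) , walk′ , maximal

  module _ (acyclic : Acyclic G) where

    branches-disjoint : ∀ {u p q} → SimpleWalk (u ∷ p) → SimpleWalk (u ∷ q) → head p ≢ head q → Disjoint p q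
    branches-disjoint {u} {y ∷ p} {y′ ∷ q} walk@((uy , _) , uyp!) walk′@((uy′ , _) , uy′q!) y≢y′ (v∈ , v∈′)
      with W , path , W⊆ ← connecting-path p q (SimpleWalk-tail walk) (SimpleWalk-tail walk′) v∈ v∈′ =
      acyclic (u ∷ W) (cycle-through path (y≢y′ ∘ cong just) uy (Adjacent-sym uy′)
        (λ u∈W → Sum.[ Unique[x∷xs]⇒x∉xs uyp! , Unique[x∷xs]⇒x∉xs uy′q! ] (W⊆ u∈W)))

    path-unique : ∀ {u v p q} → IsPath G u v p → IsPath G u v q → p ≡ q
    path-unique {p = u ∷ p} {q = _ ∷ q} path@(refl , _) path′@(refl , _) =
      cong (u ∷_) (tails-equal p q path path′)
      where
      tails-equal : ∀ {u v} (p q : List V) → IsPath G u v (u ∷ p) → IsPath G u v (u ∷ q) → p ≡ q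
      tails-equal []      []      _ _ = refl
      tails-equal []      (y ∷ q) (_ , refl , _) (_ , lst , _ , q!) =
        ⊥-elim (Unique[x∷xs]⇒x∉xs q! (last⇒∈ (y ∷ q) lst))
      tails-equal (y ∷ p) []      (_ , lst , _ , p!) (_ , refl , _) =
        ⊥-elim (Unique[x∷xs]⇒x∉xs p! (last⇒∈ (y ∷ p) lst))
      tails-equal (y ∷ p) (y′ ∷ q) path@(_ , lst , walk) path′@(_ , lst′ , walk′) with y Fin.≟ y′
      ... | yes refl = cong (y ∷_) (tails-equal p q (IsPath-tail path) (IsPath-tail path′))
      ... | no y≢y′  = ⊥-elim (branches-disjoint walk walk′ (y≢y′ ∘ just-injective)
                                 (last⇒∈ (y ∷ p) lst , last⇒∈ (y′ ∷ q) lst′))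

    path-geodesic : ∀ {u v p} → IsPath G u v p → IsGeodesic G u v p
    path-geodesic path = path , λ _ path′ → ℕ.≤-reflexive (cong length (path-unique path path′))

    no-chord : ∀ {x y z t} → SimpleWalk (x ∷ y ∷ t) → Adjacent x z → z ∉ t
    no-chord walk@(_ , (x∉ ∷ y∉ ∷ _)) xz z∈t =
      branches-disjoint walk ((xz , tt) , (lookup x∉ (there z∈t) ∷ []) ∷ [] ∷ [])
        (lookup y∉ z∈t ∘ just-injective) (there z∈t , here refl)

    leaf-walk : ∀ {a b} → Adjacent a b → ∃₂ λ x y → ∃₂ λ t r →
                SimpleWalk (x ∷ y ∷ t) × reverse (x ∷ y ∷ t) ≡ a ∷ b ∷ r × degree G x ≡ 1
    leaf-walk {a} {b} ab
      with pre , x , y , t , eq , walk@((xy , _) , _) , maximal ←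
             extend-to-maximal ((Adjacent-sym ab , tt) , (Adjacent⇒≢ (Adjacent-sym ab) ∷ []) ∷ [] ∷ []) =
      x , y , t , reverse pre , walk , trans (cong reverse eq) (reverse-++ pre (b ∷ a ∷ [])) ,
      degree≡1 xy only-neighbour
      where
      only-neighbour : ∀ z → Adjacent x z → z ≡ y
      only-neighbour z xz with maximal z xz
      ... | here refl         = ⊥-elim (Adjacent-irrefl xz)
      ... | there (here refl) = refl
      ... | there (there z∈t) = ⊥-elim (no-chord walk xz z∈t)

    first-edge-on-path : ∀ {a b c d x f r r′} → IsPath G a x (a ∷ b ∷ r) → IsPath G c x (c ∷ d ∷ r′) →
                         HasEnds f c d → c ∈ a ∷ b ∷ r → EdgeOn G f (a ∷ b ∷ r)
    first-edge-on-path {d = d} {f = f} {r′ = r′} (_ , lst , walk) path′ ends c∈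
      with pre , post , eq ← ∈-∃++ c∈ =
      subst (EdgeOn G f) (sym eq) (EdgeOn-++⁺ʳ pre (subst (EdgeOn G f) (sym suffix≡) (inj₁ ends)))
      where
      suffix≡ : _ ∷ post ≡ _ ∷ d ∷ r′
      suffix≡ = path-unique (IsPath-suffix pre (subst (λ p → last p ≡ _) eq lst) (subst SimpleWalk eq walk))
                            path′

    path-through-both-first-edges : ∀ {a b c d x r r′} → IsPath G a x (a ∷ b ∷ r) → IsPath G c x (c ∷ d ∷ r′) →
      a ∉ c ∷ d ∷ r′ →
      ∃₂ λ r″ w → IsPath G a w (a ∷ b ∷ r″) × (∀ {f} → HasEnds f c d → EdgeOn G f (a ∷ b ∷ r″))
    path-through-both-first-edges {a} {b} {c} {d} {x} {r} {r′}
      path@(_ , lst , walk@((ab , _) , ab!)) path′@(_ , lst′ , walk′@((cd , _) , cd!)) a∉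
      with c ∈? a ∷ b ∷ r
    ... | yes c∈ = r , x , path , λ ends → first-edge-on-path path path′ ends c∈
    ... | no c∉
      with connecting-path r r′ (SimpleWalk-tail walk) (SimpleWalk-tail walk′)
                           (last⇒∈ (b ∷ r) lst) (last⇒∈ (d ∷ r′) lst′)
    ... | b ∷ W , W-path@(refl , W-lst , _) , W⊆ =
      W ∷ʳ c , c ,
      IsPath-++ IsPath-[ a ] (IsPath-++ W-path IsPath-[ c ] (Adjacent-sym cd) W#c) ab a#W ,
      λ ends → EdgeOn-junction (a ∷ b ∷ W) W-lst (HasEnds-swap ends)
      where
      W#c : Disjoint (b ∷ W) [ c ]
      W#c (c∈W , here refl) = Sum.[ c∉ ∘ there , Unique[x∷xs]⇒x∉xs cd! ] (W⊆ c∈W)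
      a#W : Disjoint [ a ] (b ∷ W ∷ʳ c)
      a#W (here refl , a∈) with ∈-++⁻ (b ∷ W) a∈
      ... | inj₁ a∈W         = Sum.[ Unique[x∷xs]⇒x∉xs ab! , a∉ ∘ there ] (W⊆ a∈W)
      ... | inj₂ (here refl) = c∉ (here refl)

    module _ {S : List (V × V)} (S-gp : IsEdgeGPSet G S) where

      private
        S-edge : ∀ {e} → e ∈ S → IsEdge G e
        S-edge = lookup (proj₁ (proj₁ S-gp))

        S-unique : Unique S
        S-unique = proj₂ (proj₁ S-gp)

      Crowded : V → V → V × V → Set
      Crowded a b e = ∃₂ λ r w → ∃ λ f → IsPath G a w (a ∷ b ∷ r) × f ∈ S × f ≢ e × EdgeOn G f (a ∷ b ∷ r)

      EdgeOn-drop-first : ∀ {e f a b r} → e ∈ S → f ∈ S → f ≢ e → HasEnds e a b →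
                          EdgeOn G f (a ∷ b ∷ r) → EdgeOn G f (b ∷ r)
      EdgeOn-drop-first e∈ f∈ f≢e e-ends (inj₁ f-ends) =
        ⊥-elim (f≢e (IsEdge-unique (S-edge f∈) (S-edge e∈) f-ends e-ends))
      EdgeOn-drop-first _  _  _   _      (inj₂ on)     = on

      sides-not-both-crowded : ∀ {e a b} → e ∈ S → HasEnds e a b → Crowded a b e → Crowded b a e → ⊥
      sides-not-both-crowded {e} {a} {b} e∈ ends
        (r₁ , w₁ , f₁ , path₁@(_ , _ , walk₁@((ab , _) , ab!)) , f₁∈ , f₁≢e , on₁)
        (r₂ , w₂ , f₂ , path₂@(_ , _ , walk₂@(_ , ba!)) , f₂∈ , f₂≢e , on₂) =
        proj₂ S-gp w₂ w₁ Q (path-geodesic Q-path)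
          (e , f₁ , f₂ , e∈ , f₁∈ , f₂∈ , f₁≢e ∘ sym , f₂≢e ∘ sym , f₁≢f₂ ,
           EdgeOn-junction (reverse (a ∷ r₂)) (last-reverse (a ∷ r₂)) ends ,
           EdgeOn-++⁺ʳ (reverse (a ∷ r₂)) on₁′ ,
           EdgeOn-++⁺ˡ (reverse (a ∷ r₂)) (EdgeOn-reverse (a ∷ r₂) on₂′))
        where
        on₁′ : EdgeOn G f₁ (b ∷ r₁)
        on₁′ = EdgeOn-drop-first e∈ f₁∈ f₁≢e ends on₁
        on₂′ : EdgeOn G f₂ (a ∷ r₂)
        on₂′ = EdgeOn-drop-first e∈ f₂∈ f₂≢e (HasEnds-swap ends) on₂
        branches : Disjoint (a ∷ r₂) (b ∷ r₁)
        branches (v∈ , here refl) = Unique[x∷xs]⇒x∉xs ba! v∈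
        branches (v∈ , there v∈r₁) = branches-disjoint walk₂ (SimpleWalk-tail walk₁) a≢head (v∈ , v∈r₁)
          where
          a≢head : just a ≢ head r₁
          a≢head eq = Unique[x∷xs]⇒x∉xs ab! (there (head⇒∈ r₁ (sym eq)))
        Q : List V
        Q = reverse (a ∷ r₂) ++ b ∷ r₁
        Q-path : IsPath G w₂ w₁ Q
        Q-path = IsPath-++ (IsPath-reverse (IsPath-tail path₂)) (IsPath-tail path₁) ab
                   (λ (v∈ , v∈′) → branches (Any.reverse⁻ v∈ , v∈′))
        f₁≢f₂ : f₁ ≢ f₂
        f₁≢f₂ refl = branches (EdgeOn⇒∈ (a ∷ r₂) on₂′ , EdgeOn⇒∈ (b ∷ r₁) on₁′)

      -- The walk runs from the leaf x back to e; reversed, it is a path a, b, …, y, x whose last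
      -- edge g is pendant.
      record LeafRoute (e g : V × V) : Set where
        constructor leafRoute
        field
          a b x y   : V
          t r       : List V
          e-ends    : HasEnds e a b
          uncrowded : ¬ Crowded a b e
          walk      : SimpleWalk (x ∷ y ∷ t)
          reversed  : reverse (x ∷ y ∷ t) ≡ a ∷ b ∷ r
          leaf      : degree G x ≡ 1
          g-edge    : IsEdge G g
          g-ends    : HasEnds g y x

        path : IsPath G a x (a ∷ b ∷ r)
        path = subst (IsPath G a x) reversed
          (IsPath-reverse (refl , trans (sym (head-reverse (x ∷ y ∷ t))) (cong head reversed) , walk))

      route : ∀ {e a b} → HasEnds e a b → Adjacent a b → ¬ Crowded a b e →
              ∃ λ g → g ∈ pendantEdges G × LeafRoute e g
      route {a = a} {b} ends ab uncrowded
        with x , y , t , r , walk@((xy , _) , _) , reversed , leaf ← leaf-walk ab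
        with g , g-edge , g-ends ← canonical-edge (Adjacent-sym xy) =
        g , ∈-pendantEdges⁺ g-edge (Pendant-intro g-ends leaf) ,
        leafRoute a b x y t r ends uncrowded walk reversed leaf g-edge g-ends

      ¬¬-route : ∀ {e} → e ∈ S → ¬ ¬ (∃ λ g → g ∈ pendantEdges G × LeafRoute e g)
      ¬¬-route {i , j} e∈ with _ , ij ← S-edge e∈ =
        ¬¬-map Sum.[ route (inj₁ refl) ij , route (inj₂ refl) (Adjacent-sym ij) ]
               (¬¬-¬⊎¬ (sides-not-both-crowded e∈ (inj₁ refl)))

      LeafRoute-of-isolated-edge : ∀ {e g} → e ∈ S → (ρ : LeafRoute e g) → degree G (LeafRoute.y ρ) ≡ 1 → e ≡ g
      LeafRoute-of-isolated-edge e∈ (leafRoute _ _ _ _ []      _ e-ends _ _    refl _ g-edge g-ends) _ =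
        IsEdge-unique (S-edge e∈) g-edge e-ends g-ends
      LeafRoute-of-isolated-edge _  (leafRoute _ _ _ _ (_ ∷ _) _ _      _ walk _    _ _      _)      leaf-y =
        ⊥-elim (degree≥2⇒≢1 (interior-degree≥2 walk) leaf-y)

      LeafRoute-injective : ∀ {e f g} → e ∈ S → f ∈ S → LeafRoute e g → LeafRoute f g → e ≡ f
      LeafRoute-injective {e} {f} e∈ f∈ ρ σ with ≡-dec Fin._≟_ Fin._≟_ e f
      ... | yes e≡f = e≡f
      ... | no e≢f = ⊥-elim (distinct ρ σ)
        where
        open LeafRoute
        distinct : ∀ {g} → LeafRoute e g → LeafRoute f g → ⊥
        distinct ρ@(leafRoute a _ x y _ _ _ _ _ _ leaf-x _ ends) σ@(leafRoute c d _ _ _ r′ _ _ _ _ leaf-x′ _ ends′)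
          with HasEnds-cases ends ends′
        ... | inj₂ (refl , refl) =
          e≢f (trans (LeafRoute-of-isolated-edge e∈ ρ leaf-x′) (sym (LeafRoute-of-isolated-edge f∈ σ leaf-x)))
        ... | inj₁ (refl , refl) with a ∈? c ∷ d ∷ r′
        ...   | yes a∈ =
          uncrowded σ (r′ , x , e , path σ , e∈ , e≢f , first-edge-on-path (path σ) (path ρ) (e-ends ρ) a∈)
        ...   | no a∉ with r″ , w , path″ , on ← path-through-both-first-edges (path ρ) (path σ) a∉ =
          uncrowded ρ (r″ , w , f , path″ , f∈ , e≢f ∘ sym , on (e-ends σ))

      -- Choosing an uncrowded side of each edge of S is classical, but the goal is decidable.
      length≤pendantEdges : length S ≤ length (pendantEdges G)
      length≤pendantEdges = decidable-stable (length S ℕ.≤? length (pendantEdges G))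
        (¬¬-map (λ routes → length-≤-by-injection LeafRoute S-unique (lookup routes) LeafRoute-injective)
                (sequenceM _ ¬¬-Monad (tabulate ¬¬-route)))

theorem3p3 : (n : ℕ) (T : Graph n) → IsTree T → GpeIs T (length (pendantEdges T))
theorem3p3 n T (_ , acyclic) =
  (pendantEdges T , pendantEdges-isEdgeGPSet T , refl) , λ _ S-gp → length≤pendantEdges T acyclic S-gp
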